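{- Let $k$ be a positive integer. For every bipartite graph $G$, $$f_k(G)\geq f_k^{cyc}(G)\geq \frac{e(G)}{k-a_k},$$ where $e(G)$ is the number of edges of $G$ and $a_k$ is defined in the context.
   Context: For a graph $G$ and a positive integer $k$, a $k$-radius sequence for $G$ is a finite sequence $x_1,\ldots,x_M$ of vertices of $G$ (repetitions allowed) such that for every edge $uv$ of $G$ there are indices $i,j$ with $x_i=u$, $x_j=v$ and $|i-j|\leq k$; $f_k(G)$ is the minimum length of such a sequence. A cyclic $k$-radius sequence for $G$ is a sequence $x_1,\ldots,x_M$ of vertices such that for every edge $uv$ there are $i,j$ with $x_i=u$, $x_j=v$ and $\min(|i-j|,M-|i-j|)\leq k$; $f_k^{cyc}(G)$ is the minimum length of such a sequence. The de Bruijn graph $B_k$ is the directed graph whose vertices are all binary strings of length $k$, with an arc from $u_1\ldots u_k$ to $v_1\ldots v_k$ whenever $u_2\ldots u_k=v_1\ldots v_{k-1}$; this arc is identified with the binary string $e=e_0e_1\ldots e_k=u_1v_1\ldots v_k$ of length $k+1$. The weight $t_k(e)$ of an arc is the number of $i\in\{1,\ldots,k\}$ with $e_i=e_0$. A cycle in $B_k$ is a closed directed walk with at least one arc and no repeated vertices; its weight $t_k(C)$ is the sum of weights of its arcs and $|C|$ its number of arcs. $a_k=\min\{t_k(C)/|C|: C\text{ a cycle in }B_k\}$. -}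

module Defs where

open import Data.Bool using (Bool; true; false; if_then_else_; _∧_)
open import Data.Nat using (ℕ; zero; suc; _≤_; _<ᵇ_; ∣_-_∣; _∸_)
open import Data.Nat as ℕ using ()
open import Data.Fin using (Fin; zero; suc; toℕ; fromℕ; inject₁)
open import Data.List using (List; length; lookup; map; allFin)
open import Data.Nat.ListAction using (sum)
open import Data.Vec using (Vec; init; tail)
open import Data.Integer using (+_)
open import Data.Rational using (ℚ; _/_)
open import Data.Product using (Σ; ∃; ∃-syntax; _×_)
open import Data.Sum using (_⊎_)
open import Relation.Binary.PropositionalEquality using (_≡_; _≢_)

record Graph : Set where
  field
    n     : ℕ
    adj   : Fin n → Fin n → Bool
    sym   : ∀ u v → adj u v ≡ adj v u
    irrefl : ∀ u → adj u u ≡ false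
open Graph public

Bipartite : Graph → Set
Bipartite G = Σ (Fin (n G) → Bool) λ c → ∀ u v → adj G u v ≡ true → c u ≢ c v

edgeCount : Graph → ℕ
edgeCount G =
  sum (map (λ u → sum (map (λ v →
        if adj G u v ∧ (toℕ u <ᵇ toℕ v) then 1 else 0)
      (allFin (n G)))) (allFin (n G)))

-- k-radius sequences (positions are 0-based; only differences matter)

IsRadiusSeq : ℕ → (G : Graph) → List (Fin (n G)) → Set
IsRadiusSeq k G s = ∀ u v → adj G u v ≡ true →
  ∃[ i ] ∃[ j ] (lookup s i ≡ u × lookup s j ≡ v × ∣ toℕ i - toℕ j ∣ ≤ k)

IsCyclicRadiusSeq : ℕ → (G : Graph) → List (Fin (n G)) → Set
IsCyclicRadiusSeq k G s = ∀ u v → adj G u v ≡ true →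
  ∃[ i ] ∃[ j ] (lookup s i ≡ u × lookup s j ≡ v ×
    (∣ toℕ i - toℕ j ∣ ≤ k ⊎ length s ∸ ∣ toℕ i - toℕ j ∣ ≤ k))

IsMinLength : {A : Set} → (List A → Set) → ℕ → Set
IsMinLength {A} P m =
  (Σ (List A) λ s → P s × length s ≡ m) × (∀ s → P s → m ≤ length s)

IsFk : ℕ → Graph → ℕ → Set
IsFk k G = IsMinLength (IsRadiusSeq k G)

IsFkCyc : ℕ → Graph → ℕ → Set
IsFkCyc k G = IsMinLength (IsCyclicRadiusSeq k G)

-- de Bruijn graph B_k: vertices Vec Bool k; an arc is a string
-- e = e_0 … e_k : Vec Bool (suc k), going from init e to tail e.

boolEq : Bool → Bool → Bool
boolEq true  true  = true
boolEq false false = true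
boolEq _     _     = false

arcWeight : ∀ {k} → Vec Bool (suc k) → ℕ
arcWeight (e₀ Data.Vec.∷ es) =
  Data.Vec.sum (Data.Vec.map (λ b → if boolEq b e₀ then 1 else 0) es)

record Cycle (k : ℕ) : Set where
  field
    len      : ℕ
    arc      : Fin (suc len) → Vec Bool (suc k)
    consec   : ∀ (i : Fin len) → tail (arc (inject₁ i)) ≡ init (arc (suc i))
    close    : tail (arc (fromℕ len)) ≡ init (arc zero)
    distinct : ∀ i j → init (arc i) ≡ init (arc j) → i ≡ j
open Cycle public

cycleWeight : ∀ {k} → Cycle k → ℕ
cycleWeight C = sum (map (λ i → arcWeight (arc C i)) (allFin (suc (len C))))

cycleRatio : ∀ {k} → Cycle k → ℚ
cycleRatio C = (+ cycleWeight C) / suc (len C)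

IsAk : ℕ → ℚ → Set
IsAk k a = (Σ (Cycle k) λ C → a ≡ cycleRatio C) ×
           (∀ (C : Cycle k) → a Data.Rational.≤ cycleRatio C)

-- Extend a cyclic k-radius sequence x of length M periodically and colour it by a proper
-- 2-colouring c of G.  Every edge of G occurs as a pair (x_t, x_{t+1+d}) with t < M, d < k,
-- and such a pair is bichromatic, so e(G) is at most the number of bichromatic pairs, which is
-- kM - W where W is the total weight of the closed walk in B_k traced by the colour word
-- c(x_0) c(x_1) ….  Cutting this closed walk at a repeated vertex splits it into two shorter
-- closed walks whose weights add up, so it is a union of cycles of B_k, each of ratio at least
-- a_k; hence W ≥ a_k M and e(G) ≤ M (k - a_k).
module Submission where

open import Defs hiding (sym)
open import Data.Nat using (ℕ; _≤_)
open import Data.Product using (_×_)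
open import Data.Integer using (+_)
open import Data.Rational using (ℚ; _*_; _-_; _/_)
open import Data.Rational as ℚ using ()

open import Data.Bool using (Bool; true; false; if_then_else_; not; _∧_; T)
open import Data.Bool.Properties using (T-≡) renaming (_≟_ to _≟ᵇ_)
open import Data.Empty using (⊥-elim)
open import Data.Fin as Fin using (Fin; toℕ)
open import Data.Fin.Properties using (toℕ-inject₁; toℕ-fromℕ; toℕ-fromℕ<; toℕ<n; toℕ-injective; any?)
import Data.Integer as ℤ
import Data.Integer.Properties as ℤ
import Data.Integer.Tactic.RingSolver as ℤ-Solver
open import Data.List as List using (List; []; _∷_; allFin; tabulate)
open import Data.List.Properties using (map-tabulate; map-cong)
open import Data.Nat as ℕ using (zero; suc; _+_; _∸_; ∣_-_∣; _<_; z≤n; z<s; s<s; NonZero; _%_)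
open import Data.Nat.DivMod using ([m+n]%n≡m%n; m<n⇒m%n≡m; _mod_)
open import Data.Nat.Induction using (<-rec)
open import Data.Nat.ListAction using (sum)
open import Data.Nat.Properties
open import Algebra.Properties.CommutativeSemigroup +-commutativeSemigroup
  using (interchange; xy∙z≈x∙zy; xy∙z≈xz∙y)
open import Data.Nat.Tactic.RingSolver using (solve-∀)
open import Data.Product using (∃₂; ∃-syntax; _,_; proj₁; proj₂)
open import Data.Rational using (mkℚ; ↥_; ↧_; toℚᵘ)
import Data.Rational.Properties as ℚ
open import Data.Rational.Unnormalised as ℚᵘ using (ℚᵘ; mkℚᵘ)
import Data.Rational.Unnormalised.Properties as ℚᵘ
open import Data.Sum as Sum using (_⊎_; inj₁; inj₂)
open import Data.Vec as Vec using (Vec; []; _∷_)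
open import Data.Vec.Properties using (∷-injectiveˡ; ∷-injectiveʳ; ≡-dec)
open import Function using (_∘_; Equivalence)
open import Relation.Binary.Definitions using (DecidableEquality; tri<; tri≈; tri>)
open import Relation.Binary.PropositionalEquality
open import Relation.Nullary using (yes; no)

∑ : ℕ → (ℕ → ℕ) → ℕ
∑ zero    f = 0
∑ (suc n) f = f 0 + ∑ n (f ∘ suc)

syntax ∑ n (λ i → e) = ∑[ i < n ] e

∑-cong : ∀ n {f g : ℕ → ℕ} → (∀ i → i < n → f i ≡ g i) → ∑ n f ≡ ∑ n g
∑-cong zero    f≡g = refl
∑-cong (suc n) f≡g = cong₂ _+_ (f≡g 0 z<s) (∑-cong n (λ i i<n → f≡g (suc i) (s<s i<n)))

∑-+ : ∀ m n f → ∑ (m + n) f ≡ ∑ m f + ∑[ i < n ] f (m + i)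
∑-+ zero    n f = refl
∑-+ (suc m) n f = trans (cong (λ z → f 0 + z) (∑-+ m n (f ∘ suc))) (sym (+-assoc (f 0) _ _))

∑-last : ∀ n f → ∑ (suc n) f ≡ ∑ n f + f n
∑-last zero    f = +-comm (f 0) 0
∑-last (suc n) f = trans (cong (λ z → f 0 + z) (∑-last n (f ∘ suc))) (sym (+-assoc (f 0) _ _))

∑-distrib : ∀ n f g → ∑[ i < n ] (f i + g i) ≡ ∑ n f + ∑ n g
∑-distrib zero    f g = refl
∑-distrib (suc n) f g =
  trans (cong (λ z → f 0 + g 0 + z) (∑-distrib n (f ∘ suc) (g ∘ suc))) (interchange (f 0) (g 0) _ _)

∑-const : ∀ n c → ∑[ _ < n ] c ≡ n ℕ.* c
∑-const zero    c = refl
∑-const (suc n) c = cong (λ z → c + z) (∑-const n c)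

∑-zero : ∀ n → ∑[ _ < n ] 0 ≡ 0
∑-zero n = trans (∑-const n 0) (*-zeroʳ n)

term≤∑ : ∀ n f {i} → i < n → f i ≤ ∑ n f
term≤∑ (suc n) f {zero}  _         = m≤m+n (f 0) _
term≤∑ (suc n) f {suc i} (s<s i<n) = ≤-trans (term≤∑ n (f ∘ suc) i<n) (m≤n+m _ (f 0))

Periodic : {A : Set} → ℕ → (ℕ → A) → Set
Periodic p f = ∀ i → f (i + p) ≡ f i

∑-rotate-once : ∀ p (f : ℕ → ℕ) → f p ≡ f 0 → ∑ p (f ∘ suc) ≡ ∑ p f
∑-rotate-once zero    f _     = refl
∑-rotate-once (suc p) f fp≡f0 = begin
  ∑ (suc p) (f ∘ suc)       ≡⟨ ∑-last p (f ∘ suc) ⟩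
  ∑ p (f ∘ suc) + f (suc p) ≡⟨ cong (λ z → ∑ p (f ∘ suc) + z) fp≡f0 ⟩
  ∑ p (f ∘ suc) + f 0       ≡⟨ +-comm _ (f 0) ⟩
  ∑ (suc p) f               ∎
  where open ≡-Reasoning

∑-rotate : ∀ p b (f : ℕ → ℕ) → Periodic p f → ∑[ i < p ] f (b + i) ≡ ∑ p f
∑-rotate p zero    f per = refl
∑-rotate p (suc b) f per = trans (∑-rotate p b (f ∘ suc) (per ∘ suc)) (∑-rotate-once p f (per 0))

ind : Bool → ℕ
ind b = if b then 1 else 0

ind-not : ∀ b → ind (not b) + ind b ≡ 1
ind-not true  = refl
ind-not false = refl

∑-ind-not : ∀ n (b : ℕ → Bool) → ∑[ i < n ] ind (not (b i)) + ∑[ i < n ] ind (b i) ≡ n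
∑-ind-not n b = begin
  ∑[ i < n ] ind (not (b i)) + ∑[ i < n ] ind (b i) ≡⟨ sym (∑-distrib n _ _) ⟩
  ∑[ i < n ] (ind (not (b i)) + ind (b i))          ≡⟨ ∑-cong n (λ i _ → ind-not (b i)) ⟩
  ∑[ _ < n ] 1                                      ≡⟨ trans (∑-const n 1) (*-identityʳ n) ⟩
  n                                                 ∎
  where open ≡-Reasoning

∑-ind-≡ᵇ : ∀ n j → j < n → ∑[ i < n ] ind (i ℕ.≡ᵇ j) ≡ 1
∑-ind-≡ᵇ (suc n) zero    _         = cong suc (∑-zero n)
∑-ind-≡ᵇ (suc n) (suc j) (s<s j<n) = ∑-ind-≡ᵇ n j j<n

sum-map-zero : {A : Set} (xs : List A) → sum (List.map (λ _ → 0) xs) ≡ 0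
sum-map-zero []       = refl
sum-map-zero (_ ∷ xs) = sum-map-zero xs

sum-map-mono : {A : Set} (xs : List A) {f g : A → ℕ} → (∀ x → f x ≤ g x) →
               sum (List.map f xs) ≤ sum (List.map g xs)
sum-map-mono []       f≤g = z≤n
sum-map-mono (x ∷ xs) f≤g = +-mono-≤ (f≤g x) (sum-map-mono xs f≤g)

sum-map-∑ : {A : Set} (xs : List A) (n : ℕ) (f : A → ℕ → ℕ) →
            sum (List.map (λ x → ∑ n (f x)) xs) ≡ ∑[ i < n ] sum (List.map (λ x → f x i) xs)
sum-map-∑ []       n f = sym (∑-zero n)
sum-map-∑ (x ∷ xs) n f = trans (cong (λ z → ∑ n (f x) + z) (sum-map-∑ xs n f)) (sym (∑-distrib n (f x) _))

sum-map-∑₂ : {A : Set} (xs : List A) (m n : ℕ) (f : A → ℕ → ℕ → ℕ) →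
             sum (List.map (λ x → ∑[ i < m ] ∑ n (f x i)) xs) ≡
             ∑[ i < m ] ∑[ j < n ] sum (List.map (λ x → f x i j) xs)
sum-map-∑₂ xs m n f = trans (sum-map-∑ xs m _) (∑-cong m (λ i _ → sum-map-∑ xs n (λ x → f x i)))

sum-allFin : ∀ n (f : Fin n → ℕ) (g : ℕ → ℕ) → (∀ i → f i ≡ g (toℕ i)) →
             sum (List.map f (allFin n)) ≡ ∑ n g
sum-allFin n f g f≡g = trans (cong sum (map-tabulate (λ i → i) f)) (sum-tabulate n f g f≡g)
  where
  sum-tabulate : ∀ n (f : Fin n → ℕ) (g : ℕ → ℕ) → (∀ i → f i ≡ g (toℕ i)) → sum (tabulate f) ≡ ∑ n g
  sum-tabulate zero    f g _   = refl
  sum-tabulate (suc n) f g f≡g =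
    cong₂ _+_ (f≡g Fin.zero) (sum-tabulate n (f ∘ Fin.suc) (g ∘ suc) (f≡g ∘ Fin.suc))

_==_ : ∀ {m} → Fin m → Fin m → Bool
u == v = toℕ u ℕ.≡ᵇ toℕ v

==-refl : ∀ {m} (u : Fin m) → (u == u) ≡ true
==-refl u = Equivalence.to T-≡ (≡⇒≡ᵇ (toℕ u) (toℕ u) refl)

sum-allFin-== : ∀ m (b : Fin m) → sum (List.map (λ v → ind (v == b)) (allFin m)) ≡ 1
sum-allFin-== m b =
  trans (sum-allFin m _ (λ i → ind (i ℕ.≡ᵇ toℕ b)) (λ _ → refl)) (∑-ind-≡ᵇ m (toℕ b) (toℕ<n b))

count : ∀ {m} → (Fin m → Fin m → Bool) → ℕ
count {m} R = sum (List.map (λ u → sum (List.map (λ v → ind (R u v)) (allFin m))) (allFin m))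

count-pair : ∀ {m} q (a b : Fin m) → count (λ u v → q ∧ ((u == a) ∧ (v == b))) ≡ ind q
count-pair {m} false a b =
  trans (cong sum (map-cong (λ _ → sum-map-zero (allFin m)) (allFin m))) (sum-map-zero (allFin m))
count-pair {m} true  a b = trans (cong sum (map-cong row (allFin m))) (sum-allFin-== m a)
  where
  row : ∀ u → sum (List.map (λ v → ind ((u == a) ∧ (v == b))) (allFin m)) ≡ ind (u == a)
  row u with u == a
  ... | true  = sum-allFin-== m b
  ... | false = sum-map-zero (allFin m)

hit-pair : ∀ {m} {q} {p : Fin m × Fin m} {u v} → q ≡ true → p ≡ (u , v) →
           (q ∧ ((u == proj₁ p) ∧ (v == proj₂ p))) ≡ true
hit-pair {u = u} {v} refl refl rewrite ==-refl u | ==-refl v = refl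

count-by-cover : ∀ {m} (P : Fin m → Fin m → Bool) (H : ℕ → ℕ → Fin m → Fin m → Bool) M K →
                 (∀ u v → P u v ≡ true → ∃₂ λ i d → i < M × d < K × H i d u v ≡ true) →
                 count P ≤ ∑[ i < M ] ∑[ d < K ] count (H i d)
count-by-cover {m} P H M K cover = begin
  count P
    ≤⟨ sum-map-mono FA (λ u → sum-map-mono FA (covered u)) ⟩
  sum (List.map (λ u → sum (List.map (λ v → ∑[ i < M ] ∑[ d < K ] ind (H i d u v)) FA)) FA)
    ≡⟨ cong sum (map-cong (λ u → sum-map-∑₂ FA M K (λ v i d → ind (H i d u v))) FA) ⟩
  sum (List.map (λ u → ∑[ i < M ] ∑[ d < K ] sum (List.map (λ v → ind (H i d u v)) FA)) FA)
    ≡⟨ sum-map-∑₂ FA M K _ ⟩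
  ∑[ i < M ] ∑[ d < K ] count (H i d)
    ∎
  where
  open ≤-Reasoning
  FA : List (Fin m)
  FA = allFin m
  covered : ∀ u v → ind (P u v) ≤ ∑[ i < M ] ∑[ d < K ] ind (H i d u v)
  covered u v with P u v in Puv
  ... | false = z≤n
  ... | true with cover u v Puv
  ...   | i , d , i<M , d<K , hit =
    ≤-trans (≤-reflexive (cong ind (sym hit)))
            (≤-trans (term≤∑ K (λ d → ind (H i d u v)) d<K) (term≤∑ M (λ i → ∑[ d < K ] ind (H i d u v)) i<M))

drop : {A : Set} → ℕ → (ℕ → A) → ℕ → A
drop b w t = w (t + b)

drop-suc : {A : Set} (w : ℕ → A) (b t : ℕ) → drop b w (suc t) ≡ drop (suc b) w t
drop-suc w b t = cong w (sym (+-suc t b))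

drop-periodic : {A : Set} {p : ℕ} (b : ℕ) (w : ℕ → A) → Periodic p w → Periodic p (drop b w)
drop-periodic {p = p} b w per i = trans (cong w (xy∙z≈xz∙y i p b)) (per (i + b))

prefix : {A : Set} → (ℕ → A) → (m : ℕ) → Vec A m
prefix w zero    = []
prefix w (suc m) = w 0 ∷ prefix (w ∘ suc) m

prefix-cong : {A : Set} {v w : ℕ → A} → ∀ m → (∀ t → t < m → v t ≡ w t) → prefix v m ≡ prefix w m
prefix-cong zero    v≡w = refl
prefix-cong (suc m) v≡w = cong₂ _∷_ (v≡w 0 z<s) (prefix-cong m (λ t t<m → v≡w (suc t) (s<s t<m)))

prefix-injective : {A : Set} {v w : ℕ → A} → ∀ m → prefix v m ≡ prefix w m → ∀ t → t < m → v t ≡ w t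
prefix-injective (suc m) eq zero    _         = ∷-injectiveˡ eq
prefix-injective (suc m) eq (suc t) (s<s t<m) = prefix-injective m (∷-injectiveʳ eq) t t<m

init-prefix : {A : Set} (w : ℕ → A) (m : ℕ) → Vec.init (prefix w (suc m)) ≡ prefix w m
init-prefix w zero    = refl
init-prefix w (suc m) = cong (w 0 ∷_) (init-prefix (w ∘ suc) m)

sum-prefix : {A : Set} (f : A → ℕ) (w : ℕ → A) (m : ℕ) →
             Vec.sum (Vec.map f (prefix w m)) ≡ ∑[ t < m ] f (w t)
sum-prefix f w zero    = refl
sum-prefix f w (suc m) = cong (λ z → f (w 0) + z) (sum-prefix f (w ∘ suc) m)

periodise : {A : Set} (q : ℕ) .{{_ : NonZero q}} → (ℕ → A) → ℕ → A
periodise q w j = w (j % q)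

periodise-periodic : {A : Set} (q : ℕ) .{{_ : NonZero q}} (v : ℕ → A) → Periodic q (periodise q v)
periodise-periodic q v i = cong v ([m+n]%n≡m%n i q)

periodise-agrees : {A : Set} (q : ℕ) .{{_ : NonZero q}} (v : ℕ → A) (k : ℕ) →
                   (∀ s → s < k → v (s + q) ≡ v s) → ∀ j → j < k + q → periodise q v j ≡ v j
periodise-agrees q v zero    _   j j<q = cong v (m<n⇒m%n≡m j<q)
periodise-agrees q v (suc k) rep j j<1+k+q with m<1+n⇒m<n∨m≡n j<1+k+q
... | inj₁ j<k+q = periodise-agrees q v k (λ s s<k → rep s (m<n⇒m<1+n s<k)) j j<k+q
... | inj₂ refl  = begin
  v ((k + q) % q) ≡⟨ cong v ([m+n]%n≡m%n k q) ⟩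
  v (k % q)       ≡⟨ periodise-agrees q v k (λ s s<k → rep s (m<n⇒m<1+n s<k)) k (m<m+n k (ℕ.>-nonZero⁻¹ q)) ⟩
  v k             ≡⟨ sym (rep k (n<1+n k)) ⟩
  v (k + q)       ∎
  where open ≡-Reasoning

injective-or-collision : {A : Set} → DecidableEquality A → ∀ {n} (f : Fin n → A) →
                         (∀ i j → f i ≡ f j → i ≡ j) ⊎ ∃₂ λ i j → toℕ i < toℕ j × f i ≡ f j
injective-or-collision _≟_ {zero}  f = inj₁ λ ()
injective-or-collision _≟_ {suc n} f with any? (λ j → f Fin.zero ≟ f (Fin.suc j))
... | yes (j , eq) = inj₂ (Fin.zero , Fin.suc j , z<s , eq)
... | no  ¬eq with injective-or-collision _≟_ (f ∘ Fin.suc)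
...   | inj₂ (i , j , i<j , eq) = inj₂ (Fin.suc i , Fin.suc j , s<s i<j , eq)
...   | inj₁ inj = inj₁ λ where
          Fin.zero    Fin.zero    _  → refl
          Fin.zero    (Fin.suc j) eq → ⊥-elim (¬eq (j , eq))
          (Fin.suc i) Fin.zero    eq → ⊥-elim (¬eq (i , sym eq))
          (Fin.suc i) (Fin.suc j) eq → cong Fin.suc (inj i j eq)

period-split : ∀ {b c l} → b < c → c < suc l → ∃₂ λ q′ r′ → l ≡ q′ + suc r′ × c ≡ suc q′ + b
period-split {b} b<c c<1+l with m≤n⇒∃[o]m+o≡n b<c | m≤n⇒∃[o]m+o≡n (m<1+n⇒m≤n c<1+l)
... | q′ , refl | o , refl = q′ , b + o , rearrangeˡ b q′ o , rearrangeᶜ b q′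
  where
  rearrangeˡ : ∀ b q′ o → suc (b + q′) + o ≡ q′ + suc (b + o)
  rearrangeˡ = solve-∀
  rearrangeᶜ : ∀ b q′ → suc (b + q′) ≡ suc q′ + b
  rearrangeᶜ = solve-∀

-- a · L ≤ W says a * L ≤ W, cross-multiplied by the denominator of a.
data _·_≤_ (a : ℚ) (L W : ℕ) : Set where
  *≤* : ↥ a ℤ.* + L ℤ.≤ + W ℤ.* ↧ a → a · L ≤ W

·≤-zero : ∀ a → a · 0 ≤ 0
·≤-zero a = *≤* (ℤ.≤-reflexive (trans (ℤ.*-zeroʳ (↥ a)) (sym (ℤ.*-zeroˡ (↧ a)))))

·≤-+ : ∀ {a L₁ L₂ W₁ W₂} → a · L₁ ≤ W₁ → a · L₂ ≤ W₂ → a · (L₁ + L₂) ≤ (W₁ + W₂)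
·≤-+ {a} {L₁} {L₂} {W₁} {W₂} (*≤* le₁) (*≤* le₂) =
  *≤* (subst₂ ℤ._≤_ lhs rhs (ℤ.+-mono-≤ le₁ le₂))
  where
  lhs : ↥ a ℤ.* + L₁ ℤ.+ ↥ a ℤ.* + L₂ ≡ ↥ a ℤ.* + (L₁ + L₂)
  lhs = trans (sym (ℤ.*-distribˡ-+ (↥ a) (+ L₁) (+ L₂))) (cong (↥ a ℤ.*_) (sym (ℤ.pos-+ L₁ L₂)))
  rhs : + W₁ ℤ.* ↧ a ℤ.+ + W₂ ℤ.* ↧ a ≡ + (W₁ + W₂) ℤ.* ↧ a
  rhs = trans (sym (ℤ.*-distribʳ-+ (↧ a) (+ W₁) (+ W₂))) (cong (ℤ._* ↧ a) (sym (ℤ.pos-+ W₁ W₂)))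

≤/⇒·≤ : ∀ a W l → a ℚ.≤ + W / suc l → a · suc l ≤ W
≤/⇒·≤ a@(mkℚ _ _ _) W l a≤W/l
  with ℚᵘ.≤-respʳ-≃ (ℚ.toℚᵘ-fromℚᵘ (mkℚᵘ (+ W) l)) (ℚ.toℚᵘ-mono-≤ a≤W/l)
... | ℚᵘ.*≤* cross = *≤* cross

e+W≤kM⇒e↧a+↥aM≤kM↧a : ∀ a e W M k → e + W ≤ k ℕ.* M → a · M ≤ W →
                       + e ℤ.* ↧ a ℤ.+ ↥ a ℤ.* + M ℤ.≤ + k ℤ.* + M ℤ.* ↧ a
e+W≤kM⇒e↧a+↥aM≤kM↧a a@(mkℚ α δ _) e W M k e+W≤kM (*≤* aM≤W) = begin
  + e ℤ.* D ℤ.+ α ℤ.* + M ≤⟨ ℤ.+-monoʳ-≤ (+ e ℤ.* D) aM≤W ⟩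
  + e ℤ.* D ℤ.+ + W ℤ.* D ≡⟨ sym (ℤ.*-distribʳ-+ D (+ e) (+ W)) ⟩
  (+ e ℤ.+ + W) ℤ.* D     ≡⟨ cong (ℤ._* D) (sym (ℤ.pos-+ e W)) ⟩
  + (e + W) ℤ.* D         ≤⟨ ℤ.*-monoʳ-≤-nonNeg D (ℤ.+≤+ e+W≤kM) ⟩
  + (k ℕ.* M) ℤ.* D       ≡⟨ cong (ℤ._* D) (ℤ.pos-* k M) ⟩
  + k ℤ.* + M ℤ.* D       ∎
  where
  open ℤ.≤-Reasoning
  D : ℤ.ℤ
  D = + suc δ

toℚᵘ-/1 : ∀ n → toℚᵘ (+ n / 1) ℚᵘ.≃ mkℚᵘ (+ n) 0
toℚᵘ-/1 n = ℚ.toℚᵘ-fromℚᵘ (mkℚᵘ (+ n) 0)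

e+W≤kM⇒e≤M[k-a] : ∀ a e W M k → e + W ≤ k ℕ.* M → a · M ≤ W → + e / 1 ℚ.≤ + M / 1 * (+ k / 1 - a)
e+W≤kM⇒e≤M[k-a] a@(mkℚ α δ _) e W M k e+W≤kM aM≤W =
  ℚ.toℚᵘ-cancel-≤ (ℚᵘ.≤-respʳ-≃ (ℚᵘ.≃-sym toℚᵘ-rhs)
                    (ℚᵘ.≤-respˡ-≃ (ℚᵘ.≃-sym (toℚᵘ-/1 e)) (ℚᵘ.*≤* cross)))
  where
  D : ℤ.ℤ
  D = + suc δ
  rhs : ℚᵘ
  rhs = mkℚᵘ (+ M) 0 ℚᵘ.* (mkℚᵘ (+ k) 0 ℚᵘ.- mkℚᵘ α δ)
  toℚᵘ-rhs : toℚᵘ (+ M / 1 * (+ k / 1 - a)) ℚᵘ.≃ rhs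
  toℚᵘ-rhs = ℚᵘ.≃-trans (ℚ.toℚᵘ-homo-* (+ M / 1) (+ k / 1 - a))
               (ℚᵘ.*-cong (toℚᵘ-/1 M) (ℚᵘ.≃-trans (ℚ.toℚᵘ-homo-+ (+ k / 1) (ℚ.- a))
                                                   (ℚᵘ.+-cong (toℚᵘ-/1 k) (ℚ.toℚᵘ-homo‿- a))))
  ↧rhs : ℚᵘ.denominator rhs ≡ D
  ↧rhs = cong (λ d → + suc d) (trans (+-identityʳ (δ + 0)) (+-identityʳ δ))
  cross : + e ℤ.* ℚᵘ.denominator rhs ℤ.≤ ℚᵘ.numerator rhs ℤ.* + 1
  cross = begin
    + e ℤ.* ℚᵘ.denominator rhs            ≡⟨ cong (+ e ℤ.*_) ↧rhs ⟩
    + e ℤ.* D                             ≡⟨ cancel (+ e ℤ.* D) (α ℤ.* + M) ⟩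
    + e ℤ.* D ℤ.+ α ℤ.* + M ℤ.- α ℤ.* + M
      ≤⟨ ℤ.+-monoˡ-≤ (ℤ.- (α ℤ.* + M)) (e+W≤kM⇒e↧a+↥aM≤kM↧a a e W M k e+W≤kM aM≤W) ⟩
    + k ℤ.* + M ℤ.* D ℤ.- α ℤ.* + M       ≡⟨ factor (+ k) (+ M) D α ⟩
    + M ℤ.* (+ k ℤ.* D ℤ.+ ℤ.- α ℤ.* + 1) ℤ.* + 1 ∎
    where
    open ℤ.≤-Reasoning
    cancel : ∀ x y → x ≡ x ℤ.+ y ℤ.- y
    cancel = ℤ-Solver.solve-∀
    factor : ∀ k m d α → k ℤ.* m ℤ.* d ℤ.- α ℤ.* m ≡ m ℤ.* (k ℤ.* d ℤ.+ ℤ.- α ℤ.* + 1) ℤ.* + 1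
    factor = ℤ-Solver.solve-∀

-- Periodic binary words as closed walks in the de Bruijn graph

-- The i-th step of the walk of w goes from vertexAt w i to vertexAt w (suc i) along arcAt w i.
module DeBruijn (k : ℕ) where

  vertexAt : (ℕ → Bool) → ℕ → Vec Bool k
  vertexAt w i = prefix (drop i w) k

  arcAt : (ℕ → Bool) → ℕ → Vec Bool (suc k)
  arcAt w i = prefix (drop i w) (suc k)

  weight : (ℕ → Bool) → ℕ → ℕ
  weight w i = arcWeight (arcAt w i)

  init-arcAt : ∀ w i → Vec.init (arcAt w i) ≡ vertexAt w i
  init-arcAt w i = init-prefix (drop i w) k

  tail-arcAt : ∀ w i → Vec.tail (arcAt w i) ≡ vertexAt w (suc i)
  tail-arcAt w i = prefix-cong k (λ t _ → drop-suc w i t)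

  vertexAt-drop : ∀ b (w : ℕ → Bool) i → vertexAt (drop b w) i ≡ vertexAt w (i + b)
  vertexAt-drop b w i = prefix-cong k (λ t _ → cong w (+-assoc t i b))

  weight-cong : ∀ (v w : ℕ → Bool) i j → (∀ t → t < suc k → v (t + i) ≡ w (t + j)) → weight v i ≡ weight w j
  weight-cong v w i j agree = cong arcWeight (prefix-cong (suc k) agree)

  weight-drop : ∀ b (w : ℕ → Bool) i → weight (drop b w) i ≡ weight w (b + i)
  weight-drop b w i = weight-cong (drop b w) w i (b + i) (λ t _ → cong w (xy∙z≈x∙zy t i b))

  weight-periodic : ∀ {p} (w : ℕ → Bool) → Periodic p w → Periodic p (weight w)
  weight-periodic {p} w per i =
    weight-cong w w (i + p) i (λ t _ → trans (cong w (sym (+-assoc t i p))) (per (t + i)))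

  weight-rotate : ∀ p b (w : ℕ → Bool) → Periodic p w → ∑ p (weight (drop b w)) ≡ ∑ p (weight w)
  weight-rotate p b w per =
    trans (∑-cong p (λ i _ → weight-drop b w i)) (∑-rotate p b (weight w) (weight-periodic w per))

  weight-periodise : (q : ℕ) .{{_ : NonZero q}} (v : ℕ → Bool) → (∀ s → s < k → v (s + q) ≡ v s) →
                     ∀ i → i < q → weight (periodise q v) i ≡ weight v i
  weight-periodise q v rep i i<q = weight-cong (periodise q v) v i i
    (λ t t<1+k → periodise-agrees q v k rep (t + i) (+-mono-≤-< (m<1+n⇒m≤n t<1+k) i<q))

  -- A walk that is back at its starting vertex after q steps is the concatenation of two
  -- closed walks, of lengths q and r.
  weight-split : ∀ q r .{{_ : NonZero q}} .{{_ : NonZero r}} (v : ℕ → Bool) → Periodic (q + r) v →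
                 vertexAt v 0 ≡ vertexAt v q →
                 ∑ (q + r) (weight v) ≡ ∑ q (weight (periodise q v)) + ∑ r (weight (periodise r (drop q v)))
  weight-split q r v per repeat = begin
    ∑ (q + r) (weight v)                         ≡⟨ ∑-+ q r (weight v) ⟩
    ∑ q (weight v) + ∑[ i < r ] weight v (q + i) ≡⟨ cong₂ _+_ first second ⟩
    ∑ q (weight (periodise q v)) + ∑ r (weight (periodise r (drop q v))) ∎
    where
    open ≡-Reasoning
    rep : ∀ s → s < k → v (s + q) ≡ v s
    rep s s<k = trans (sym (prefix-injective k repeat s s<k)) (cong v (+-identityʳ s))
    rep′ : ∀ s → s < k → drop q v (s + r) ≡ drop q v s
    rep′ s s<k = trans (cong v (xy∙z≈x∙zy s r q)) (trans (per s) (sym (rep s s<k)))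
    first : ∑ q (weight v) ≡ ∑ q (weight (periodise q v))
    first = ∑-cong q (λ i i<q → sym (weight-periodise q v rep i i<q))
    second : ∑[ i < r ] weight v (q + i) ≡ ∑ r (weight (periodise r (drop q v)))
    second = ∑-cong r (λ i i<r →
      trans (sym (weight-drop q v i)) (sym (weight-periodise r (drop q v) rep′ i i<r)))

  wordCycle : ∀ l (w : ℕ → Bool) → Periodic (suc l) w →
              (∀ i j → vertexAt w (toℕ i) ≡ vertexAt w (toℕ j) → i ≡ j) → Cycle k
  wordCycle l w per distinct = record
    { len      = l
    ; arc      = arcAt w ∘ toℕ
    ; consec   = λ i → trans (tail-arcAt w _)
                          (trans (cong (vertexAt w ∘ suc) (toℕ-inject₁ i)) (sym (init-arcAt w _)))
    ; close    = trans (tail-arcAt w _)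
                   (trans (cong (vertexAt w ∘ suc) (toℕ-fromℕ l)) (trans back-to-start (sym (init-arcAt w 0))))
    ; distinct = λ i j eq → distinct i j (trans (sym (init-arcAt w _)) (trans eq (init-arcAt w _)))
    }
    where
    back-to-start : vertexAt w (suc l) ≡ vertexAt w 0
    back-to-start = prefix-cong k (λ t _ → trans (per t) (cong w (sym (+-identityʳ t))))

  cycleWeight-wordCycle : ∀ l w per distinct → cycleWeight (wordCycle l w per distinct) ≡ ∑ (suc l) (weight w)
  cycleWeight-wordCycle l w per distinct = sum-allFin (suc l) _ (weight w) (λ _ → refl)

  module _ (a : ℚ) (a≤ratio : ∀ (C : Cycle k) → a ℚ.≤ cycleRatio C) where

    PeriodBound : ℕ → Set
    PeriodBound l = ∀ (w : ℕ → Bool) → Periodic (suc l) w → a · suc l ≤ ∑ (suc l) (weight w)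

    bound-at-repeat : ∀ q′ r′ (v : ℕ → Bool) → Periodic (suc q′ + suc r′) v →
                      vertexAt v 0 ≡ vertexAt v (suc q′) → PeriodBound q′ → PeriodBound r′ →
                      a · (suc q′ + suc r′) ≤ ∑ (suc q′ + suc r′) (weight v)
    bound-at-repeat q′ r′ v per repeat bound-q bound-r =
      subst (a · (suc q′ + suc r′) ≤_) (sym (weight-split (suc q′) (suc r′) v per repeat))
        (·≤-+ (bound-q _ (periodise-periodic (suc q′) v))
              (bound-r _ (periodise-periodic (suc r′) (drop (suc q′) v))))

    -- The closed walk is either a cycle of B_k or, rotated to start at a repeated vertex,
    -- splits into two shorter closed walks.
    periodic-weight-bound : ∀ l → PeriodBound l
    periodic-weight-bound = <-rec PeriodBound bound
      where
      bound : ∀ l → (∀ {m} → m < l → PeriodBound m) → PeriodBound l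
      bound l rec w per with injective-or-collision (≡-dec _≟ᵇ_) (vertexAt w ∘ toℕ)
      ... | inj₁ distinct = subst (a · suc l ≤_) (cycleWeight-wordCycle l w per distinct)
                                  (≤/⇒·≤ a _ l (a≤ratio (wordCycle l w per distinct)))
      ... | inj₂ (i , j , i<j , repeat) with period-split i<j (toℕ<n j)
      ...   | q′ , r′ , refl , j≡ =
        subst (a · suc l ≤_) (weight-rotate (suc l) (toℕ i) w per)
          (bound-at-repeat q′ r′ (drop (toℕ i) w) (drop-periodic (toℕ i) w per) repeat′
             (rec (m<m+n q′ z<s)) (rec (m≤n+m (suc r′) q′)))
        where
        repeat′ : vertexAt (drop (toℕ i) w) 0 ≡ vertexAt (drop (toℕ i) w) (suc q′)
        repeat′ = trans (vertexAt-drop (toℕ i) w 0)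
                    (trans repeat (trans (cong (vertexAt w) j≡) (sym (vertexAt-drop (toℕ i) w (suc q′)))))

-- Cyclic radius sequences of bipartite graphs

ProperColouring : (G : Graph) → (Fin (n G) → Bool) → Set
ProperColouring G c = ∀ u v → adj G u v ≡ true → c u ≢ c v

-- edgeCount G is count (orderedEdge G) by definition.
orderedEdge : (G : Graph) → Fin (n G) → Fin (n G) → Bool
orderedEdge G u v = adj G u v ∧ (toℕ u ℕ.<ᵇ toℕ v)

radius⇒cyclic : ∀ {k G s} → IsRadiusSeq k G s → IsCyclicRadiusSeq k G s
radius⇒cyclic rs u v uv with rs u v uv
... | i , j , sᵢ≡u , sⱼ≡v , near = i , j , sᵢ≡u , sⱼ≡v , inj₁ near

boolEq-≢ : ∀ {b b′} → b ≢ b′ → boolEq b b′ ≡ false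
boolEq-≢ {true}  {true}  b≢b′ = ⊥-elim (b≢b′ refl)
boolEq-≢ {true}  {false} _    = refl
boolEq-≢ {false} {true}  _    = refl
boolEq-≢ {false} {false} b≢b′ = ⊥-elim (b≢b′ refl)

_≐_ : {A : Set} → A × A → A × A → Set
p ≐ (u , v) = p ≡ (u , v) ⊎ p ≡ (v , u)

sort₂ : ∀ {m} → Fin m × Fin m → Fin m × Fin m
sort₂ (p , q) = if toℕ q ℕ.<ᵇ toℕ p then (q , p) else (p , q)

sort₂-≐ : ∀ {m} {p : Fin m × Fin m} {u v} → toℕ u < toℕ v → p ≐ (u , v) → sort₂ p ≡ (u , v)
sort₂-≐ {u = u} {v} u<v (inj₁ refl) with toℕ v ℕ.<ᵇ toℕ u in v<ᵇu
... | false = refl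
... | true  = ⊥-elim (<-asym u<v (<ᵇ⇒< (toℕ v) (toℕ u) (Equivalence.from T-≡ v<ᵇu)))
sort₂-≐ {u = u} {v} u<v (inj₂ refl) with toℕ u ℕ.<ᵇ toℕ v in u<ᵇv
... | true  = refl
... | false = ⊥-elim (subst T u<ᵇv (<⇒<ᵇ u<v))

∣m-1+m+n∣≡1+n : ∀ m n → ∣ m - suc (m + n) ∣ ≡ suc n
∣m-1+m+n∣≡1+n m n = trans (cong (λ z → ∣ m - z ∣) (sym (+-suc m n))) (∣m-m+n∣≡n m (suc n))

module CyclicSequence (k : ℕ) (G : Graph) (s : List (Fin (n G))) .{{_ : NonZero (List.length s)}}
                      (rs : IsCyclicRadiusSeq k G s) where

  M : ℕ
  M = List.length s

  x : ℕ → Fin (n G)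
  x i = List.lookup s (i mod M)

  x-periodic : Periodic M x
  x-periodic i = cong (List.lookup s) (toℕ-injective
    (trans (toℕ-fromℕ< _) (trans ([m+n]%n≡m%n i M) (sym (toℕ-fromℕ< _)))))

  x-lookup : ∀ (i : Fin M) → x (toℕ i) ≡ List.lookup s i
  x-lookup i = cong (List.lookup s) (toℕ-injective (trans (toℕ-fromℕ< _) (m<n⇒m%n≡m (toℕ<n i))))

  pairAt : ℕ → ℕ → Fin (n G) × Fin (n G)
  pairAt t d = x t , x (suc (d + t))

  Joins : ℕ → ℕ → Fin (n G) → Fin (n G) → Set
  Joins t d u v = t < M × d < k × pairAt t d ≐ (u , v)

  close-positions-joined : ∀ i j → i < j → j < M → (∣ i - j ∣ ≤ k ⊎ M ∸ ∣ i - j ∣ ≤ k) →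
                           ∃₂ λ t d → Joins t d (x i) (x j)
  close-positions-joined i j i<j j<M close with m≤n⇒∃[o]m+o≡n i<j | m≤n⇒∃[o]m+o≡n j<M
  ... | e , refl | o , M≡ with close
  ...   | inj₁ near = i , e , <-trans i<j j<M , subst (_≤ k) (∣m-1+m+n∣≡1+n i e) near ,
                      inj₁ (cong (λ z → x i , x (suc z)) (+-comm e i))
  ...   | inj₂ wrap = suc (i + e) , i + o , j<M , subst (_≤ k) wrapped wrap ,
                      inj₂ (cong (x (suc (i + e)) ,_) around)
    where
    M-split : M ≡ suc e + suc (i + o)
    M-split = trans (sym M≡) (rearrange i e o)
      where
      rearrange : ∀ i e o → suc (suc (i + e)) + o ≡ suc e + suc (i + o)
      rearrange = solve-∀
    wrapped : M ∸ ∣ i - suc (i + e) ∣ ≡ suc (i + o)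
    wrapped = trans (cong₂ _∸_ M-split (∣m-1+m+n∣≡1+n i e)) (m+n∸m≡n (suc e) (suc (i + o)))
    around : x (suc (i + o + suc (i + e))) ≡ x i
    around = trans (cong x (trans (rearrange i e o) (cong (λ z → i + z) M≡))) (x-periodic i)
      where
      rearrange : ∀ i e o → suc (i + o + suc (i + e)) ≡ i + (suc (suc (i + e)) + o)
      rearrange = solve-∀

  edge-joined : ∀ u v → adj G u v ≡ true → ∃₂ λ t d → Joins t d u v
  edge-joined u v uv with rs u v uv
  ... | i , j , sᵢ≡u , sⱼ≡v , close with <-cmp (toℕ i) (toℕ j)
  ...   | tri< i<j _ _ = subst₂ Joined (trans (x-lookup i) sᵢ≡u) (trans (x-lookup j) sⱼ≡v)
                           (close-positions-joined (toℕ i) (toℕ j) i<j (toℕ<n j) close)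
    where
    Joined : Fin (n G) → Fin (n G) → Set
    Joined p q = ∃₂ λ t d → Joins t d p q
  ...   | tri> _ _ j<i = subst₂ Joined (trans (x-lookup i) sᵢ≡u) (trans (x-lookup j) sⱼ≡v)
                           (swap-ends (close-positions-joined (toℕ j) (toℕ i) j<i (toℕ<n i)
                              (subst (λ z → z ≤ k ⊎ M ∸ z ≤ k) (∣-∣-comm (toℕ i) (toℕ j)) close)))
    where
    Joined : Fin (n G) → Fin (n G) → Set
    Joined p q = ∃₂ λ t d → Joins t d p q
    swap-ends : ∀ {p q} → Joined q p → Joined p q
    swap-ends (t , d , t<M , d<k , joins) = t , d , t<M , d<k , Sum.swap joins
  ...   | tri≈ _ i≡j _ = ⊥-elim (true≢false (trans (sym uv) (trans (cong (adj G u) v≡u) (irrefl G u))))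
    where
    v≡u : v ≡ u
    v≡u = trans (sym sⱼ≡v) (trans (cong (List.lookup s) (toℕ-injective (sym i≡j))) sᵢ≡u)
    true≢false : true ≢ false
    true≢false ()

  module _ (c : Fin (n G) → Bool) where

    colour : ℕ → Bool
    colour = c ∘ x

    bichromatic : ℕ → ℕ → Bool
    bichromatic t d = not (boolEq (colour (suc (d + t))) (colour t))

    joined-edge-bichromatic : ProperColouring G c →
                              ∀ {t d u v} → adj G u v ≡ true → Joins t d u v → bichromatic t d ≡ true
    joined-edge-bichromatic proper uv (_ , _ , inj₁ refl) =
      cong not (boolEq-≢ (proper _ _ (trans (Graph.sym G _ _) uv)))
    joined-edge-bichromatic proper uv (_ , _ , inj₂ refl) = cong not (boolEq-≢ (proper _ _ uv))

    -- The pair at (t, d) can only account for the edge formed by its sorted endpoints.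
    edgeCount≤bichromatic : ProperColouring G c → edgeCount G ≤ ∑[ t < M ] ∑[ d < k ] ind (bichromatic t d)
    edgeCount≤bichromatic proper =
      ≤-trans (count-by-cover (orderedEdge G) hits M k cover)
        (≤-reflexive (∑-cong M (λ t _ → ∑-cong k (λ d _ →
          count-pair (bichromatic t d) (proj₁ (sort₂ (pairAt t d))) (proj₂ (sort₂ (pairAt t d)))))))
      where
      hits : ℕ → ℕ → Fin (n G) → Fin (n G) → Bool
      hits t d u v = bichromatic t d ∧ ((u == proj₁ (sort₂ (pairAt t d))) ∧ (v == proj₂ (sort₂ (pairAt t d))))
      cover : ∀ u v → orderedEdge G u v ≡ true → ∃₂ λ t d → t < M × d < k × hits t d u v ≡ true
      cover u v edge with adj G u v in uv
      ... | true with edge-joined u v uv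
      ...   | t , d , joins@(t<M , d<k , pair≐uv) =
        t , d , t<M , d<k , hit-pair (joined-edge-bichromatic proper uv joins)
                              (sort₂-≐ (<ᵇ⇒< (toℕ u) (toℕ v) (Equivalence.from T-≡ edge)) pair≐uv)

    bichromatic+weight : ∑[ t < M ] ∑[ d < k ] ind (bichromatic t d) + ∑ M (DeBruijn.weight k colour) ≡ M ℕ.* k
    bichromatic+weight = begin
      B + ∑ M (DeBruijn.weight k colour)
        ≡⟨ cong (λ z → B + z) (∑-cong M (λ t _ → sum-prefix _ (drop t colour ∘ suc) k)) ⟩
      B + ∑[ t < M ] ∑[ d < k ] ind (monochromatic t d)
        ≡⟨ sym (∑-distrib M _ _) ⟩
      ∑[ t < M ] (∑[ d < k ] ind (not (monochromatic t d)) + ∑[ d < k ] ind (monochromatic t d))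
        ≡⟨ ∑-cong M (λ t _ → ∑-ind-not k (monochromatic t)) ⟩
      ∑[ _ < M ] k
        ≡⟨ ∑-const M k ⟩
      M ℕ.* k ∎
      where
      open ≡-Reasoning
      B : ℕ
      B = ∑[ t < M ] ∑[ d < k ] ind (bichromatic t d)
      monochromatic : ℕ → ℕ → Bool
      monochromatic t d = boolEq (colour (suc (d + t))) (colour t)

edges+weight≤ : ∀ k G → Bipartite G → ∀ a → (∀ (C : Cycle k) → a ℚ.≤ cycleRatio C) →
                ∀ s → IsCyclicRadiusSeq k G s →
                ∃[ W ] (edgeCount G + W ≤ k ℕ.* List.length s × a · List.length s ≤ W)
edges+weight≤ k G _ a _ [] rs =
  0 , subst₂ _≤_ (sym (+-identityʳ _)) (sym (*-zeroʳ k)) (count-by-cover _ (λ _ _ _ _ → false) 0 k no-edge) ,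
  ·≤-zero a
  where
  no-edge : ∀ u v → orderedEdge G u v ≡ true → ∃₂ λ i d → i < 0 × d < k × false ≡ true
  no-edge u v edge with adj G u v in uv
  ... | true with rs u v uv
  ...   | () , _
edges+weight≤ k G (c , proper) a a≤ratio s@(_ ∷ s′) rs =
  ∑ M (weight (colour c)) ,
  ≤-trans (+-monoˡ-≤ _ (edgeCount≤bichromatic c proper))
          (≤-reflexive (trans (bichromatic+weight c) (*-comm M k))) ,
  periodic-weight-bound a a≤ratio (List.length s′) (colour c) (λ i → cong c (x-periodic i))
  where
  open CyclicSequence k G s rs
  open DeBruijn k

corollary3 : ∀ (k : ℕ) → 1 ≤ k → ∀ (G : Graph) → Bipartite G →
    ∀ (f fc : ℕ) (a : ℚ) → IsFk k G f → IsFkCyc k G fc → IsAk k a →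
    fc ≤ f × ((+ edgeCount G) / 1) ℚ.≤ ((+ fc) / 1) * (((+ k) / 1) - a)
corollary3 k _ G bipartite f fc a ((s₀ , radius₀ , f≡) , _) ((s , cyclic , fc≡) , fc-minimal) (_ , a≤ratio)
  with edges+weight≤ k G bipartite a a≤ratio s cyclic
... | W , e+W≤kM , aM≤W =
  subst (fc ≤_) f≡ (fc-minimal s₀ (radius⇒cyclic {k} {G} {s₀} radius₀)) ,
  subst (λ M → + edgeCount G / 1 ℚ.≤ + M / 1 * (+ k / 1 - a)) fc≡
    (e+W≤kM⇒e≤M[k-a] a (edgeCount G) W (List.length s) k e+W≤kM aM≤W)
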